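{- Let $D$ be a one-way split digraph of order $n$ with no sinks. Then $D$ has a quasi-kernel of size at most $\frac{n+3}{2}-\sqrt{n}$. Furthermore, for infinitely many values of $n$ there exists a one-way split digraph of order $n$ with no sink such that the minimum size of its quasi-kernels is exactly $\frac{n+3}{2}-\sqrt{n}$.
   Context: A one-way split digraph is a digraph $D$ whose vertex set can be partitioned into sets $X$ and $Y$ such that $X$ is independent, $D[Y]$ is semicomplete (at least one arc between every pair of distinct vertices of $Y$), and every arc between $X$ and $Y$ goes from $X$ to $Y$. A sink is a vertex with no out-neighbour. A quasi-kernel of $D$ is an independent set $Q\subseteq V(D)$ such that for every vertex $v\in V(D)\setminus Q$ there is a directed path with one or two arcs from $v$ to some vertex of $Q$. -}

module Defs where

open import Data.Nat using (ℕ; _+_; _*_; _∸_; _≤_)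
open import Data.Bool using (Bool; true; false; T)
open import Data.Fin using (Fin)
open import Data.Fin.Subset using (Subset; _∈_; _∉_; ∣_∣)
open import Data.Product using (Σ; ∃; ∃-syntax; _×_)
open import Data.Sum using (_⊎_)
open import Relation.Nullary using (¬_)
open import Relation.Binary.PropositionalEquality using (_≡_; _≢_)

record Digraph (n : ℕ) : Set where
  field
    arc      : Fin n → Fin n → Bool
    loopless : ∀ v → arc v v ≡ false

open Digraph public

Arc : ∀ {n} → Digraph n → Fin n → Fin n → Set
Arc D u v = T (arc D u v)

NoSinks : ∀ {n} → Digraph n → Set
NoSinks {n} D = ∀ (v : Fin n) → ∃[ w ] Arc D v w

-- Partition V = X ∪ Y given by the indicator inX (Y = complement of X).
-- X independent, D[Y] semicomplete, every arc between X and Y goes X → Y.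
IsOneWaySplitPartition : ∀ {n} → Digraph n → (Fin n → Bool) → Set
IsOneWaySplitPartition {n} D inX =
    (∀ (u v : Fin n) → T (inX u) → T (inX v) → ¬ Arc D u v)
  × (∀ (u v : Fin n) → inX u ≡ false → inX v ≡ false → u ≢ v → Arc D u v ⊎ Arc D v u)
  × (∀ (u v : Fin n) → inX u ≡ false → T (inX v) → ¬ Arc D u v)

OneWaySplit : ∀ {n} → Digraph n → Set
OneWaySplit {n} D = ∃[ inX ] IsOneWaySplitPartition D inX

Independent : ∀ {n} → Digraph n → Subset n → Set
Independent {n} D Q = ∀ (u v : Fin n) → u ∈ Q → v ∈ Q → ¬ Arc D u v

Reach≤2 : ∀ {n} → Digraph n → Fin n → Fin n → Set
Reach≤2 D v w = Arc D v w ⊎ (∃[ x ] (Arc D v x × Arc D x w))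

QuasiKernel : ∀ {n} → Digraph n → Subset n → Set
QuasiKernel {n} D Q =
  Independent D Q × (∀ (v : Fin n) → v ∉ Q → ∃[ q ] (q ∈ Q × Reach≤2 D v q))

-- k ≤ (n+3)/2 - √n  over the reals, written without reals:
-- equivalent to  2k ≤ n+3  and  4n ≤ (n+3-2k)^2.
AtMostBound : ℕ → ℕ → Set
AtMostBound n k = (2 * k ≤ n + 3) × (4 * n ≤ (n + 3 ∸ 2 * k) * (n + 3 ∸ 2 * k))

-- k = (n+3)/2 - √n  over the reals, written without reals:
-- n = m² (so √n = m) and 2k + 2m = n + 3.
EqualsBound : ℕ → ℕ → Set
EqualsBound n k = ∃[ m ] ((m * m ≡ n) × (2 * k + 2 * m ≡ n + 3))

MinQuasiKernelSize : ∀ {n} → Digraph n → ℕ → Set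
MinQuasiKernelSize {n} D k =
  (∃[ Q ] (QuasiKernel D Q × ∣ Q ∣ ≡ k)) × (∀ (Q : Subset n) → QuasiKernel D Q → k ≤ ∣ Q ∣)

{-# OPTIONS --safe #-}
-- Choose for every x ∈ X an out-neighbour out x ∈ Y, and let weight y count the x ∈ X with
-- out x = y or out x → y; each of them reaches y in at most two steps. A vertex y ∈ Y maximising
-- weight, and then its closed in-degree inside Y, reaches every other vertex of Y in at most two
-- steps (a vertex z it misses would satisfy y → z and score higher). So Q = {y} ∪ {x ∈ X : x does
-- not reach y in at most two steps} is a quasi-kernel with |Q| + weight y ≤ 1 + |X|. Counting
-- ordered pairs of X gives |X|² + C ≤ 2 ∑ₓ weight (out x) ≤ 2 |X| weight y, where C counts the
-- pairs with a common out-neighbour, and Cauchy–Schwarz gives |X|² ≤ |Y| C. Hence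
-- (|Y| + 1) |X| ≤ 2 |Y| weight y, and AM–GM turns this into |Q| ≤ (n + 3)/2 − √n.
--
-- For equality take as Y the rotational tournament on ℤ/(2t + 1), i → i + 1, …, i + t, and attach
-- 2t pendant vertices of X to each of its vertices. A quasi-kernel contains exactly one tournament
-- vertex i₀ and hence all 2t·t pendants of the out-neighbours of i₀, while vertex 2t together with
-- the pendants of 0, …, t − 1 is a quasi-kernel; so the minimum is 1 + 2t² with n = (2t + 1)².

module Submission where

open import Defs
open import Data.Bool using (Bool; true; false; T; not; _∧_; _∨_; if_then_else_)
open import Data.Bool.Properties using (T?; T-≡; T-∧; T-∨; T-not-≡)
open import Data.Empty using (⊥; ⊥-elim)
open import Data.Fin using (Fin; zero; suc; toℕ; fromℕ; fromℕ<; combine; remQuot; _↑ˡ_; _↑ʳ_) renaming (_≟_ to _≟ᶠ_)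
open import Data.Fin.Properties using (any?; toℕ<n; toℕ-fromℕ; toℕ-fromℕ<; toℕ-injective; remQuot-combine; combine-remQuot)
open import Data.Fin.Subset using (Subset; _∈_; _∉_; ∣_∣)
open import Data.Fin.Subset.Properties using (_∈?_)
open import Data.List using (allFin)
open import Data.List.Membership.Propositional.Properties using (∈-allFin)
import Data.List.Relation.Unary.All as All
open import Data.Nat using (ℕ; zero; suc; _+_; _*_; _∸_; _≤_; _<_; z≤n; s≤s; s≤s⁻¹; _≤?_; _<?_; _<ᵇ_; NonZero; >-nonZero)
open import Data.Nat.Properties
open import Data.Nat.Tactic.RingSolver using (solve-∀)
open import Algebra.Properties.Semiring.Sum +-*-semiring
  using (sum; sum-syntax; sum-cong-≗; ∑-distrib-+; ∑-comm; *-distribˡ-sum; *-distribʳ-sum)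
open import Data.List.Extrema ≤-totalOrder using (argmax; f[xs]≤f[argmax]; f[⊥]≤f[argmax])
open import Data.Product using (∃; ∃-syntax; _×_; _,_; proj₁; proj₂; uncurry)
open import Data.Sum using (_⊎_; inj₁; inj₂; [_,_]′)
import Data.Sum as Sum
open import Data.Vec using ([]; _∷_; lookup; tabulate)
open import Data.Vec.Properties using (lookup∘tabulate; lookup⇒[]=; []=⇒lookup)
open import Function using (_∘_; case_of_; Equivalence)
open import Relation.Binary using (tri<; tri≈; tri>)
open import Relation.Binary.PropositionalEquality
open import Relation.Nullary using (¬_; yes; no; Dec)
open import Relation.Nullary.Decidable using (⌊_⌋; _⊎-dec_; _×-dec_; toWitness; fromWitness; toWitnessFalse; fromWitnessFalse)

-- Indicators and finite sums

𝟙 : Bool → ℕ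
𝟙 true  = 1
𝟙 false = 0

𝟙≤1 : ∀ b → 𝟙 b ≤ 1
𝟙≤1 true  = ≤-refl
𝟙≤1 false = z≤n

𝟙*𝟙≤1 : ∀ b c → 𝟙 b * 𝟙 c ≤ 1
𝟙*𝟙≤1 true  c = ≤-trans (≤-reflexive (+-identityʳ (𝟙 c))) (𝟙≤1 c)
𝟙*𝟙≤1 false c = z≤n

1≤𝟙 : ∀ {b} → T b → 1 ≤ 𝟙 b
1≤𝟙 {true} _ = ≤-refl

𝟙-false : ∀ {b} → ¬ T b → 𝟙 b ≡ 0
𝟙-false {false} _  = refl
𝟙-false {true}  ¬b = ⊥-elim (¬b _)

𝟙-exclusive : ∀ {b c} → (T b → T c → ⊥) → 𝟙 b + 𝟙 c ≤ 1
𝟙-exclusive {false} {c}     _    = 𝟙≤1 c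
𝟙-exclusive {true}  {false} _    = ≤-refl
𝟙-exclusive {true}  {true}  b⊥c = ⊥-elim (b⊥c _ _)

𝟙-mono : ∀ {b c} → (T b → T c) → 𝟙 b ≤ 𝟙 c
𝟙-mono {false} _   = z≤n
𝟙-mono {true} {true}  _   = ≤-refl
𝟙-mono {true} {false} b⇒c = ⊥-elim (b⇒c _)

𝟙-< : ∀ {b c} → ¬ T b → T c → 𝟙 b < 𝟙 c
𝟙-< {false} {true} _ _ = s≤s z≤n
𝟙-< {true}         ¬b  = ⊥-elim (¬b _)

𝟙-disjoint-≤ : ∀ {b c d} → (T b → T d) → (T c → T d) → (T b → T c → ⊥) → 𝟙 b + 𝟙 c ≤ 𝟙 d
𝟙-disjoint-≤ {false} _   c⇒d _ = 𝟙-mono c⇒d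
𝟙-disjoint-≤ {true} {false} b⇒d _ _ = ≤-trans (≤-reflexive (+-identityʳ 1)) (𝟙-mono b⇒d)
𝟙-disjoint-≤ {true} {true}  _   _ b⊥c = ⊥-elim (b⊥c _ _)

_==_ : ∀ {n} → Fin n → Fin n → Bool
i == j = ⌊ i ≟ᶠ j ⌋

==-refl : ∀ {n} (i : Fin n) → T (i == i)
==-refl i = fromWitness {a? = i ≟ᶠ i} refl

==⇒≡ : ∀ {n} {i j : Fin n} → T (i == j) → i ≡ j
==⇒≡ {i = i} {j} = toWitness {a? = i ≟ᶠ j}

∑-mono-≤ : ∀ {n} {f g : Fin n → ℕ} → (∀ i → f i ≤ g i) → sum f ≤ sum g
∑-mono-≤ {zero}  f≤g = z≤n
∑-mono-≤ {suc n} f≤g = +-mono-≤ (f≤g zero) (∑-mono-≤ (f≤g ∘ suc))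

∑-mono-< : ∀ {n} {f g : Fin n → ℕ} → (∀ i → f i ≤ g i) → ∀ k → f k < g k → sum f < sum g
∑-mono-< f≤g zero    fk<gk = +-mono-<-≤ fk<gk (∑-mono-≤ (f≤g ∘ suc))
∑-mono-< f≤g (suc k) fk<gk = +-mono-≤-< (f≤g zero) (∑-mono-< (f≤g ∘ suc) k fk<gk)

∑-const : ∀ n c → ∑[ i < n ] c ≡ n * c
∑-const zero    c = refl
∑-const (suc n) c = cong (c +_) (∑-const n c)

∑-≤-card : ∀ {n} (f : Fin n → ℕ) → (∀ i → f i ≤ 1) → sum f ≤ n
∑-≤-card {n} f f≤1 = ≤-trans (∑-mono-≤ f≤1) (≤-reflexive (trans (∑-const n 1) (*-identityʳ n)))

term≤∑ : ∀ {n} (f : Fin n → ℕ) k → f k ≤ sum f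
term≤∑ f zero    = m≤m+n (f zero) _
term≤∑ f (suc k) = ≤-trans (term≤∑ (f ∘ suc) k) (m≤n+m _ (f zero))

∑-δ : ∀ {n} (a : Fin n) (f : Fin n → ℕ) → ∑[ i < n ] (𝟙 (a == i) * f i) ≡ f a
∑-δ {suc n} zero    f = trans (cong₂ _+_ (+-identityʳ (f zero)) (trans (∑-const n 0) (*-zeroʳ n))) (+-identityʳ (f zero))
∑-δ {suc n} (suc a) f = trans (sum-cong-≗ (λ i → cong (λ b → 𝟙 b * f (suc i)) (suc-== a i))) (∑-δ a (f ∘ suc))
  where
  suc-== : ∀ {n} (a i : Fin n) → (suc a == suc i) ≡ (a == i)
  suc-== a i with a ≟ᶠ i
  ... | yes _ = refl
  ... | no  _ = refl

∑-== : ∀ {n} (a : Fin n) → ∑[ i < n ] 𝟙 (a == i) ≡ 1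
∑-== {n} a = trans (sum-cong-≗ (λ i → sym (*-identityʳ (𝟙 (a == i))))) (∑-δ a (λ _ → 1))

∑-+-∑-const : ∀ {n} k (f g : Fin n → ℕ) → ∑[ i < n ] (f i + ∑[ j < k ] g i) ≡ sum f + k * sum g
∑-+-∑-const {n} k f g = begin
  ∑[ i < n ] (f i + ∑[ j < k ] g i)  ≡⟨ ∑-distrib-+ f (λ i → ∑[ j < k ] g i) ⟩
  sum f + ∑[ i < n ] ∑[ j < k ] g i  ≡⟨ cong (sum f +_) (sum-cong-≗ (λ i → ∑-const k (g i))) ⟩
  sum f + ∑[ i < n ] (k * g i)       ≡⟨ cong (sum f +_) (*-distribˡ-sum k g) ⟨
  sum f + k * sum g                  ∎
  where open ≡-Reasoning

∑-product : ∀ {m n} (f : Fin m → ℕ) (g : Fin n → ℕ) → sum f * sum g ≡ ∑[ i < m ] ∑[ j < n ] (f i * g j)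
∑-product f g = trans (*-distribʳ-sum (sum g) f) (sum-cong-≗ (λ i → *-distribˡ-sum (f i) g))

∑∑-distrib-+ : ∀ {m n} (f g : Fin m → Fin n → ℕ) →
  ∑[ i < m ] ∑[ j < n ] (f i j + g i j) ≡ ∑[ i < m ] ∑[ j < n ] f i j + ∑[ i < m ] ∑[ j < n ] g i j
∑∑-distrib-+ f g = trans (sum-cong-≗ (λ i → ∑-distrib-+ (f i) (g i))) (∑-distrib-+ (λ i → sum (f i)) (λ i → sum (g i)))

*-distribˡ-∑∑ : ∀ {m n} k (f : Fin m → Fin n → ℕ) → k * ∑[ i < m ] ∑[ j < n ] f i j ≡ ∑[ i < m ] ∑[ j < n ] (k * f i j)
*-distribˡ-∑∑ k f = trans (*-distribˡ-sum k (λ i → sum (f i))) (sum-cong-≗ (λ i → *-distribˡ-sum k (f i)))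

∑-split : ∀ k {r} (f : Fin (k + r) → ℕ) → sum f ≡ ∑[ i < k ] f (i ↑ˡ r) + ∑[ j < r ] f (k ↑ʳ j)
∑-split zero    f = refl
∑-split (suc k) f = trans (cong (f zero +_) (∑-split k (f ∘ suc))) (sym (+-assoc (f zero) _ _))

∑-combine : ∀ m {n} (f : Fin (m * n) → ℕ) → sum f ≡ ∑[ i < m ] ∑[ j < n ] f (combine i j)
∑-combine zero    f = refl
∑-combine (suc m) {n} f = trans (∑-split n f) (cong (∑[ j < n ] f (j ↑ˡ (m * n)) +_) (∑-combine m (f ∘ (n ↑ʳ_))))

∣p∣≡∑ : ∀ {n} (p : Subset n) → ∣ p ∣ ≡ ∑[ i < n ] 𝟙 (lookup p i)
∣p∣≡∑ []          = refl
∣p∣≡∑ (true ∷ p)  = cong suc (∣p∣≡∑ p)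
∣p∣≡∑ (false ∷ p) = ∣p∣≡∑ p

∣tabulate∣≡∑ : ∀ {n} (p : Fin n → Bool) → ∣ tabulate p ∣ ≡ ∑[ i < n ] 𝟙 (p i)
∣tabulate∣≡∑ p = trans (∣p∣≡∑ (tabulate p)) (sum-cong-≗ (cong 𝟙 ∘ lookup∘tabulate p))

∈-tabulate⁺ : ∀ {n} (p : Fin n → Bool) {v} → T (p v) → v ∈ tabulate p
∈-tabulate⁺ p {v} pv = lookup⇒[]= v (tabulate p) (trans (lookup∘tabulate p v) (Equivalence.to T-≡ pv))

∈-tabulate⁻ : ∀ {n} (p : Fin n → Bool) {v} → v ∈ tabulate p → T (p v)
∈-tabulate⁻ p {v} v∈ = Equivalence.from T-≡ (trans (sym (lookup∘tabulate p v)) ([]=⇒lookup v∈))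

∈⇒lookup : ∀ {n} {p : Subset n} {x} → x ∈ p → T (lookup p x)
∈⇒lookup x∈p = Equivalence.from T-≡ ([]=⇒lookup x∈p)

m*k+r≤n*k+s⇒m≤n : ∀ {m n r s} k → s < k → m * k + r ≤ n * k + s → m ≤ n
m*k+r≤n*k+s⇒m≤n {m} {n} {r} {s} k s<k le = ≮⇒≥ (λ n<m → <⇒≱ (begin-strict
    n * k + s    <⟨ +-monoʳ-< (n * k) s<k ⟩
    n * k + k    ≡⟨ +-comm (n * k) k ⟩
    suc n * k    ≤⟨ *-monoˡ-≤ k n<m ⟩
    m * k        ≤⟨ m≤m+n (m * k) r ⟩
    m * k + r    ∎) le)
  where open ≤-Reasoning

2mn≤m²+n² : ∀ m n → 2 * (m * n) ≤ m * m + n * n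
2mn≤m²+n² m n = [ ordered , (λ n≤m → subst₂ _≤_ (cong (2 *_) (*-comm n m)) (+-comm (n * n) (m * m)) (ordered n≤m)) ]′ (≤-total m n)
  where
  ordered : ∀ {m n} → m ≤ n → 2 * (m * n) ≤ m * m + n * n
  ordered {m} m≤n with d , refl ← m≤n⇒∃[o]m+o≡n m≤n =
    subst (2 * (m * (m + d)) ≤_) (square-expansion m d) (m≤m+n _ (d * d))
    where
    square-expansion : ∀ m d → 2 * (m * (m + d)) + d * d ≡ m * m + (m + d) * (m + d)
    square-expansion = solve-∀

cauchy-schwarz : ∀ {n} (w c : Fin n → ℕ) →
  (∑[ i < n ] (w i * c i)) * (∑[ i < n ] (w i * c i)) ≤ sum w * ∑[ i < n ] (w i * (c i * c i))
cauchy-schwarz {n} w c = *-cancelˡ-≤ 2 (begin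
    2 * (S * S)
  ≡⟨ cong (2 *_) (∑-product wc wc) ⟩
    2 * ∑[ i < n ] ∑[ j < n ] (wc i * wc j)
  ≡⟨ *-distribˡ-∑∑ 2 (λ i j → wc i * wc j) ⟩
    ∑[ i < n ] ∑[ j < n ] (2 * (wc i * wc j))
  ≤⟨ ∑-mono-≤ (λ i → ∑-mono-≤ (λ j → pointwise (w i) (w j) (c i) (c j))) ⟩
    ∑[ i < n ] ∑[ j < n ] (w i * wc² j + wc² i * w j)
  ≡⟨ ∑∑-distrib-+ (λ i j → w i * wc² j) (λ i j → wc² i * w j) ⟩
    ∑[ i < n ] ∑[ j < n ] (w i * wc² j) + ∑[ i < n ] ∑[ j < n ] (wc² i * w j)
  ≡⟨ cong₂ _+_ (∑-product w wc²) (∑-product wc² w) ⟨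
    sum w * sum wc² + sum wc² * sum w
  ≡⟨ cong (sum w * sum wc² +_) (*-comm (sum wc²) (sum w)) ⟩
    sum w * sum wc² + sum w * sum wc²
  ≡⟨ cong (sum w * sum wc² +_) (+-identityʳ _) ⟨
    2 * (sum w * sum wc²) ∎)
  where
  open ≤-Reasoning
  wc wc² : Fin n → ℕ
  wc i = w i * c i
  wc² i = w i * (c i * c i)
  S : ℕ
  S = sum wc
  pointwise : ∀ wi wj ci cj → 2 * ((wi * ci) * (wj * cj)) ≤ wi * (wj * (cj * cj)) + (wi * (ci * ci)) * wj
  pointwise wi wj ci cj =
    subst₂ _≤_ (lhs wi wj ci cj) (rhs wi wj ci cj) (*-monoʳ-≤ (wi * wj) (2mn≤m²+n² ci cj))
    where
    lhs : ∀ wi wj ci cj → wi * wj * (2 * (ci * cj)) ≡ 2 * ((wi * ci) * (wj * cj))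
    lhs = solve-∀
    rhs : ∀ wi wj ci cj → wi * wj * (ci * ci + cj * cj) ≡ wi * (wj * (cj * cj)) + (wi * (ci * ci)) * wj
    rhs = solve-∀

4mn≤[m+n]² : ∀ m n → 4 * (m * n) ≤ (m + n) * (m + n)
4mn≤[m+n]² m n = subst₂ _≤_ (lhs m n) (rhs m n) (+-monoʳ-≤ (2 * (m * n)) (2mn≤m²+n² m n))
  where
  lhs : ∀ m n → 2 * (m * n) + 2 * (m * n) ≡ 4 * (m * n)
  lhs = solve-∀
  rhs : ∀ m n → 2 * (m * n) + (m * m + n * n) ≡ (m + n) * (m + n)
  rhs = solve-∀

m*o*o≤n*o⇒m*o≤n : ∀ m n o → m * o * o ≤ n * o → m * o ≤ n
m*o*o≤n*o⇒m*o≤n m n zero    _  = ≤-trans (≤-reflexive (*-zeroʳ m)) z≤n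
m*o*o≤n*o⇒m*o≤n m n (suc o) le = *-cancelʳ-≤ (m * suc o) n (suc o) le

-- The hypotheses give m · gap ≥ m² + m + a, and AM–GM gives (m² + m + a)² ≥ 4 m² (a + m).
atMostBound : ∀ a m k w → 1 ≤ m → k + w ≤ 1 + a → (m + 1) * a ≤ 2 * m * w → AtMostBound (a + m) k
atMostBound a m k w 1≤m k+w≤1+a weight-bound = 2k≤n+3 , 4n≤gap²
  where
  open ≤-Reasoning
  instance
    m≢0 : NonZero m
    m≢0 = >-nonZero 1≤m
    m²≢0 : NonZero (m * m)
    m²≢0 = m*n≢0 m m
  2mk+a≤2m+ma : 2 * m * k + a ≤ 2 * m + m * a
  2mk+a≤2m+ma = +-cancelʳ-≤ (m * a) _ _ (begin
      2 * m * k + a + m * a    ≡⟨ e₁ m k a ⟩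
      2 * m * k + (m + 1) * a  ≤⟨ +-monoʳ-≤ (2 * m * k) weight-bound ⟩
      2 * m * k + 2 * m * w    ≡⟨ *-distribˡ-+ (2 * m) k w ⟨
      2 * m * (k + w)          ≤⟨ *-monoʳ-≤ (2 * m) k+w≤1+a ⟩
      2 * m * (1 + a)          ≡⟨ e₂ m a ⟩
      2 * m + m * a + m * a    ∎)
    where
    e₁ : ∀ m k a → 2 * m * k + a + m * a ≡ 2 * m * k + (m + 1) * a
    e₁ = solve-∀
    e₂ : ∀ m a → 2 * m * (1 + a) ≡ 2 * m + m * a + m * a
    e₂ = solve-∀
  2k≤2+a : 2 * k ≤ 2 + a
  2k≤2+a = *-cancelˡ-≤ m (subst₂ _≤_ (e₁ m k) (e₂ m a) (≤-trans (m≤m+n (2 * m * k) a) 2mk+a≤2m+ma))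
    where
    e₁ : ∀ m k → 2 * m * k ≡ m * (2 * k)
    e₁ = solve-∀
    e₂ : ∀ m a → 2 * m + m * a ≡ m * (2 + a)
    e₂ = solve-∀
  2k≤n+3 : 2 * k ≤ a + m + 3
  2k≤n+3 = ≤-trans 2k≤2+a (subst (2 + a ≤_) (e a m) (m≤m+n (2 + a) (m + 1)))
    where
    e : ∀ a m → 2 + a + (m + 1) ≡ a + m + 3
    e = solve-∀
  gap : ℕ
  gap = a + m + 3 ∸ 2 * k
  m²+m+a≤m*gap : m * m + m + a ≤ m * gap
  m²+m+a≤m*gap = +-cancelʳ-≤ (2 * m + m * a) _ _ (begin
      m * m + m + a + (2 * m + m * a)  ≡⟨ e₁ m a ⟩
      m * (a + m + 3) + a              ≡⟨ cong (λ z → m * z + a) (m∸n+n≡m 2k≤n+3) ⟨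
      m * (gap + 2 * k) + a            ≡⟨ e₂ m gap k a ⟩
      m * gap + (2 * m * k + a)        ≤⟨ +-monoʳ-≤ (m * gap) 2mk+a≤2m+ma ⟩
      m * gap + (2 * m + m * a)        ∎)
    where
    e₁ : ∀ m a → m * m + m + a + (2 * m + m * a) ≡ m * (a + m + 3) + a
    e₁ = solve-∀
    e₂ : ∀ m g k a → m * (g + 2 * k) + a ≡ m * g + (2 * m * k + a)
    e₂ = solve-∀
  4n≤gap² : 4 * (a + m) ≤ gap * gap
  4n≤gap² = *-cancelˡ-≤ (m * m) (begin
      m * m * (4 * (a + m))                    ≡⟨ e₁ m a ⟩
      4 * (m * m * (m + a))                    ≤⟨ 4mn≤[m+n]² (m * m) (m + a) ⟩
      (m * m + (m + a)) * (m * m + (m + a))    ≡⟨ cong (λ z → z * z) (+-assoc (m * m) m a) ⟨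
      (m * m + m + a) * (m * m + m + a)        ≤⟨ *-mono-≤ m²+m+a≤m*gap m²+m+a≤m*gap ⟩
      m * gap * (m * gap)                      ≡⟨ e₂ m gap ⟩
      m * m * (gap * gap)                      ∎)
    where
    e₁ : ∀ m a → m * m * (4 * (a + m)) ≡ 4 * (m * m * (m + a))
    e₁ = solve-∀
    e₂ : ∀ m g → m * g * (m * g) ≡ m * m * (g * g)
    e₂ = solve-∀

-- The upper bound

reach≤2? : ∀ {n} (D : Digraph n) v w → Dec (Reach≤2 D v w)
reach≤2? D v w = T? (arc D v w) ⊎-dec any? (λ x → T? (arc D v x) ×-dec T? (arc D x w))

module UpperBound {n} (D : Digraph (suc n)) (inX : Fin (suc n) → Bool)
                  (split : IsOneWaySplitPartition D inX) (noSinks : NoSinks D) where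

  V : Set
  V = Fin (suc n)

  X-independent : ∀ u v → T (inX u) → T (inX v) → ¬ Arc D u v
  X-independent = proj₁ split

  Y-semicomplete : ∀ u v → inX u ≡ false → inX v ≡ false → u ≢ v → Arc D u v ⊎ Arc D v u
  Y-semicomplete = proj₁ (proj₂ split)

  no-arc-Y→X : ∀ u v → inX u ≡ false → T (inX v) → ¬ Arc D u v
  no-arc-Y→X = proj₂ (proj₂ split)

  [X] [Y] : V → ℕ
  [X] v = 𝟙 (inX v)
  [Y] v = 𝟙 (not (inX v))

  out : V → V
  out v = proj₁ (noSinks v)

  out-arc : ∀ v → Arc D v (out v)
  out-arc v = proj₂ (noSinks v)

  out-∈Y : ∀ x → T (inX x) → inX (out x) ≡ false
  out-∈Y x x∈X with inX (out x) in eq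
  ... | false = refl
  ... | true  = ⊥-elim (X-independent x (out x) x∈X (Equivalence.from T-≡ eq) (out-arc x))

  _→⁼_ : V → V → Bool
  v →⁼ w = (v == w) ∨ arc D v w

  →⁼-refl : ∀ v → T (v →⁼ v)
  →⁼-refl v = Equivalence.from (T-∨ {v == v}) (inj₁ (==-refl v))

  arc⇒→⁼ : ∀ {v w} → Arc D v w → T (v →⁼ w)
  arc⇒→⁼ {v} {w} a = Equivalence.from (T-∨ {v == w}) (inj₂ a)

  →⁼-cases : ∀ {v w} → T (v →⁼ w) → v ≡ w ⊎ Arc D v w
  →⁼-cases {v} {w} p = Sum.map₁ ==⇒≡ (Equivalence.to (T-∨ {v == w}) p)

  -- score is lexicographic in (weight, indegY⁼), as indegY⁼ y ≤ suc n.
  weight indegY⁼ score : V → ℕ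
  weight y = ∑[ x < suc n ] ([X] x * 𝟙 (out x →⁼ y))
  indegY⁼ y = ∑[ v < suc n ] ([Y] v * 𝟙 (v →⁼ y))
  score y = weight y * suc (suc n) + indegY⁼ y

  score-increases : ∀ {y z} → inX y ≡ false → inX z ≡ false → z ≢ y → ¬ Reach≤2 D z y → score y < score z
  score-increases {y} {z} y∈Y z∈Y z≢y z↛y =
    +-mono-≤-< (*-monoˡ-≤ (suc (suc n)) (∑-mono-≤ weight-step)) (∑-mono-< indeg-step z indeg-strict)
    where
    y→z : Arc D y z
    y→z = [ (λ z→y → ⊥-elim (z↛y (inj₁ z→y))) , (λ y→z → y→z) ]′ (Y-semicomplete z y z∈Y y∈Y z≢y)
    →⁼y⇒→⁼z : ∀ v → inX v ≡ false → T (v →⁼ y) → T (v →⁼ z)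
    →⁼y⇒→⁼z v v∈Y v→⁼y with →⁼-cases v→⁼y
    ... | inj₁ refl = arc⇒→⁼ y→z
    ... | inj₂ v→y = case v ≟ᶠ z of λ where
      (yes v≡z) → ⊥-elim (z↛y (inj₁ (subst (λ w → Arc D w y) v≡z v→y)))
      (no v≢z)  → [ arc⇒→⁼ , (λ z→v → ⊥-elim (z↛y (inj₂ (v , z→v , v→y)))) ]′ (Y-semicomplete v z v∈Y z∈Y v≢z)
    weight-step : ∀ x → [X] x * 𝟙 (out x →⁼ y) ≤ [X] x * 𝟙 (out x →⁼ z)
    weight-step x with inX x in eq
    ... | false = z≤n
    ... | true  = +-monoˡ-≤ 0 (𝟙-mono (→⁼y⇒→⁼z (out x) (out-∈Y x (Equivalence.from T-≡ eq))))
    indeg-step : ∀ v → [Y] v * 𝟙 (v →⁼ y) ≤ [Y] v * 𝟙 (v →⁼ z)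
    indeg-step v with inX v in eq
    ... | true  = z≤n
    ... | false = +-monoˡ-≤ 0 (𝟙-mono (→⁼y⇒→⁼z v eq))
    z↛⁼y : ¬ T (z →⁼ y)
    z↛⁼y p = [ z≢y , (λ z→y → z↛y (inj₁ z→y)) ]′ (→⁼-cases p)
    indeg-strict : [Y] z * 𝟙 (z →⁼ y) < [Y] z * 𝟙 (z →⁼ z)
    indeg-strict rewrite z∈Y = +-monoˡ-< 0 (𝟙-< z↛⁼y (→⁼-refl z))

  score-maximiser : ∃ λ y → inX y ≡ false × (∀ v → inX v ≡ false → score v ≤ score y)
  score-maximiser = y , y∈Y , λ v v∈Y → s≤s⁻¹ (subst₂ _≤_ (rank-∈Y v v∈Y) (rank-∈Y y y∈Y) (rank≤rank-y v))
    where
    rank : V → ℕ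
    rank v = if inX v then 0 else suc (score v)
    ranked⇒∈Y : ∀ v → 0 < rank v → inX v ≡ false
    ranked⇒∈Y v with inX v
    ... | false = λ _ → refl
    ... | true  = λ ()
    rank-∈Y : ∀ v → inX v ≡ false → rank v ≡ suc (score v)
    rank-∈Y v v∈Y rewrite v∈Y = refl
    someY : ∃ λ v → inX v ≡ false
    someY with inX zero in eq
    ... | true  = out zero , out-∈Y zero (Equivalence.from T-≡ eq)
    ... | false = zero , eq
    y : V
    y = argmax rank (proj₁ someY) (allFin (suc n))
    rank≤rank-y : ∀ v → rank v ≤ rank y
    rank≤rank-y v = All.lookup (f[xs]≤f[argmax] {f = rank} (proj₁ someY) (allFin (suc n))) (∈-allFin v)
    y∈Y : inX y ≡ false
    y∈Y = ranked⇒∈Y y (≤-trans (subst (0 <_) (sym (rank-∈Y (proj₁ someY) (proj₂ someY))) (s≤s z≤n))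
                                (f[⊥]≤f[argmax] {f = rank} (proj₁ someY) (allFin (suc n))))

  module KingAbsorption (king : V) (king∈Y : inX king ≡ false)
                        (score≤score-king : ∀ v → inX v ≡ false → score v ≤ score king) where

    weight≤weight-king : ∀ v → inX v ≡ false → weight v ≤ weight king
    weight≤weight-king v v∈Y = m*k+r≤n*k+s⇒m≤n (suc (suc n)) indegY⁼<2+n (score≤score-king v v∈Y)
      where
      indegY⁼<2+n : indegY⁼ king < suc (suc n)
      indegY⁼<2+n = s≤s (∑-≤-card _ (λ u → 𝟙*𝟙≤1 (not (inX u)) (u →⁼ king)))

    king-absorbs-Y : ∀ z → inX z ≡ false → z ≢ king → Reach≤2 D z king
    king-absorbs-Y z z∈Y z≢king with reach≤2? D z king
    ... | yes z↝king = z↝king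
    ... | no z↛king = ⊥-elim (<⇒≱ (score-increases king∈Y z∈Y z≢king z↛king) (score≤score-king z z∈Y))

    inQ : V → Bool
    inQ v = if inX v then not ⌊ reach≤2? D v king ⌋ else (king == v)

    Q : Subset (suc n)
    Q = tabulate inQ

    king∈Q : king ∈ Q
    king∈Q = ∈-tabulate⁺ inQ (subst (λ b → T (if b then _ else (king == king))) (sym king∈Y) (==-refl king))

    Q-independent : Independent D Q
    Q-independent p q p∈Q q∈Q = no-arc p q (∈-tabulate⁻ inQ p∈Q) (∈-tabulate⁻ inQ q∈Q)
      where
      no-arc : ∀ p q → T (inQ p) → T (inQ q) → ¬ Arc D p q
      no-arc p q p∈ q∈ p→q with inX p in ep | inX q in eq
      ... | true  | true  = X-independent p q (Equivalence.from T-≡ ep) (Equivalence.from T-≡ eq) p→q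
      ... | false | true  = no-arc-Y→X p q ep (Equivalence.from T-≡ eq) p→q
      ... | false | false with refl ← ==⇒≡ p∈ | refl ← ==⇒≡ q∈ = subst T (loopless D king) p→q
      ... | true  | false with refl ← ==⇒≡ q∈ = toWitnessFalse p∈ (inj₁ p→q)

    X-∈Q : ∀ v → inX v ≡ true → ¬ Reach≤2 D v king → v ∈ Q
    X-∈Q v v∈X v↛king = ∈-tabulate⁺ inQ (subst (λ b → T (if b then not ⌊ reach≤2? D v king ⌋ else (king == v))) (sym v∈X)
                                                (fromWitnessFalse v↛king))

    Q-absorbing : ∀ v → v ∉ Q → ∃[ q ] (q ∈ Q × Reach≤2 D v q)
    Q-absorbing v v∉Q = king , king∈Q , v↝king
      where
      v↝king : Reach≤2 D v king
      v↝king with inX v in ev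
      ... | false = king-absorbs-Y v ev (λ { refl → v∉Q king∈Q })
      ... | true with reach≤2? D v king
      ...   | yes r = r
      ...   | no v↛king = ⊥-elim (v∉Q (X-∈Q v ev v↛king))

    Q-quasiKernel : QuasiKernel D Q
    Q-quasiKernel = Q-independent , Q-absorbing

    |X| |Y| : ℕ
    |X| = ∑[ v < suc n ] [X] v
    |Y| = ∑[ v < suc n ] [Y] v

    |X|+|Y|≡n : |X| + |Y| ≡ suc n
    |X|+|Y|≡n = begin
      |X| + |Y|                            ≡⟨ ∑-distrib-+ [X] [Y] ⟨
      ∑[ v < suc n ] ([X] v + [Y] v)       ≡⟨ sum-cong-≗ (λ v → [X]+[Y]≡1 (inX v)) ⟩
      ∑[ v < suc n ] 1                     ≡⟨ ∑-const (suc n) 1 ⟩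
      suc n * 1                            ≡⟨ *-identityʳ (suc n) ⟩
      suc n                                ∎
      where
      open ≡-Reasoning
      [X]+[Y]≡1 : ∀ b → 𝟙 b + 𝟙 (not b) ≡ 1
      [X]+[Y]≡1 true  = refl
      [X]+[Y]≡1 false = refl

    1≤|Y| : 1 ≤ |Y|
    1≤|Y| = ≤-trans (≤-reflexive (sym (cong (𝟙 ∘ not) king∈Y))) (term≤∑ [Y] king)

    out⇒reach : ∀ v → T (out v →⁼ king) → Reach≤2 D v king
    out⇒reach v p = [ (λ out≡king → inj₁ (subst (Arc D v) out≡king (out-arc v)))
                    , (λ out→king → inj₂ (out v , out-arc v , out→king)) ]′ (→⁼-cases p)

    |Q|+weight≤1+|X| : ∣ Q ∣ + weight king ≤ 1 + |X|
    |Q|+weight≤1+|X| = begin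
      ∣ Q ∣ + weight king                                               ≡⟨ cong (_+ weight king) (∣tabulate∣≡∑ inQ) ⟩
      ∑[ v < suc n ] 𝟙 (inQ v) + weight king                            ≡⟨ ∑-distrib-+ (𝟙 ∘ inQ) (λ v → [X] v * 𝟙 (out v →⁼ king)) ⟨
      ∑[ v < suc n ] (𝟙 (inQ v) + [X] v * 𝟙 (out v →⁼ king))            ≤⟨ ∑-mono-≤ pointwise ⟩
      ∑[ v < suc n ] (𝟙 (king == v) + [X] v)                            ≡⟨ ∑-distrib-+ (λ v → 𝟙 (king == v)) [X] ⟩
      ∑[ v < suc n ] 𝟙 (king == v) + |X|                                ≡⟨ cong (_+ |X|) (∑-== king) ⟩
      1 + |X|                                                           ∎
      where
      open ≤-Reasoning
      pointwise : ∀ v → 𝟙 (inQ v) + [X] v * 𝟙 (out v →⁼ king) ≤ 𝟙 (king == v) + [X] v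
      pointwise v with inX v
      ... | false = ≤-refl
      ... | true  = ≤-trans (≤-trans (≤-reflexive (cong (𝟙 (not ⌊ reach≤2? D v king ⌋) +_) (+-identityʳ _)))
                                     (𝟙-exclusive (λ ¬r p → toWitnessFalse ¬r (out⇒reach v p))))
                            (m≤n+m 1 _)

    collisions total-weight : ℕ
    collisions = ∑[ i < suc n ] ∑[ j < suc n ] ([X] i * ([X] j * 𝟙 (out i == out j)))
    total-weight = ∑[ x < suc n ] ([X] x * weight (out x))

    pair-count : ∀ p q → inX p ≡ false → inX q ≡ false → 1 + 𝟙 (p == q) ≤ 𝟙 (q →⁼ p) + 𝟙 (p →⁼ q)
    pair-count p q p∈Y q∈Y = case p ≟ᶠ q of λ where
      (yes refl) → +-mono-≤ (1≤𝟙 (→⁼-refl p)) (𝟙-mono {p == p} (λ _ → →⁼-refl p))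
      (no p≢q)   → subst (λ c → 1 + c ≤ 𝟙 (q →⁼ p) + 𝟙 (p →⁼ q)) (sym (𝟙-false (p≢q ∘ ==⇒≡)))
                     ([ (λ p→q → ≤-trans (1≤𝟙 (arc⇒→⁼ p→q)) (m≤n+m _ (𝟙 (q →⁼ p))))
                      , (λ q→p → ≤-trans (1≤𝟙 (arc⇒→⁼ q→p)) (m≤m+n _ (𝟙 (p →⁼ q)))) ]′
                        (Y-semicomplete p q p∈Y q∈Y p≢q))

    |X|²+collisions≤2*total-weight : |X| * |X| + collisions ≤ total-weight + total-weight
    |X|²+collisions≤2*total-weight = begin
        |X| * |X| + collisions
      ≡⟨ cong (_+ collisions) (∑-product [X] [X]) ⟩
        ∑[ i < suc n ] ∑[ j < suc n ] ([X] i * [X] j) + collisions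
      ≡⟨ ∑∑-distrib-+ (λ i j → [X] i * [X] j) e ⟨
        ∑[ i < suc n ] ∑[ j < suc n ] ([X] i * [X] j + e i j)
      ≤⟨ ∑-mono-≤ (λ i → ∑-mono-≤ (pointwise i)) ⟩
        ∑[ i < suc n ] ∑[ j < suc n ] (g i j + g j i)
      ≡⟨ ∑∑-distrib-+ g (λ i j → g j i) ⟩
        ∑[ i < suc n ] ∑[ j < suc n ] g i j + ∑[ i < suc n ] ∑[ j < suc n ] g j i
      ≡⟨ cong₂ _+_ total-weight≡ (trans (∑-comm (λ i j → g j i)) total-weight≡) ⟩
        total-weight + total-weight ∎
      where
      open ≤-Reasoning
      e g : V → V → ℕ
      e i j = [X] i * ([X] j * 𝟙 (out i == out j))
      g i j = [X] i * ([X] j * 𝟙 (out j →⁼ out i))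
      total-weight≡ : ∑[ i < suc n ] ∑[ j < suc n ] g i j ≡ total-weight
      total-weight≡ = sum-cong-≗ (λ i → sym (*-distribˡ-sum ([X] i) (λ j → [X] j * 𝟙 (out j →⁼ out i))))
      pointwise : ∀ i j → [X] i * [X] j + e i j ≤ g i j + g j i
      pointwise i j with inX i in ei | inX j in ej
      ... | false | _     = z≤n
      ... | true  | false = z≤n
      ... | true  | true  = subst₂ _≤_ (cong (1 +_) (sym (1*[1*x]≡x (𝟙 (out i == out j)))))
                                       (sym (cong₂ _+_ (1*[1*x]≡x (𝟙 (out j →⁼ out i))) (1*[1*x]≡x (𝟙 (out i →⁼ out j)))))
                              (pair-count (out i) (out j) (out-∈Y i (Equivalence.from T-≡ ei)) (out-∈Y j (Equivalence.from T-≡ ej)))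
        where
        1*[1*x]≡x : ∀ x → 1 * (1 * x) ≡ x
        1*[1*x]≡x x = trans (*-identityˡ (1 * x)) (*-identityˡ x)

    total-weight≤|X|*weight-king : total-weight ≤ |X| * weight king
    total-weight≤|X|*weight-king = ≤-trans (∑-mono-≤ pointwise) (≤-reflexive (sym (*-distribʳ-sum (weight king) [X])))
      where
      pointwise : ∀ x → [X] x * weight (out x) ≤ [X] x * weight king
      pointwise x with inX x in ex
      ... | false = z≤n
      ... | true  = +-monoˡ-≤ 0 (weight≤weight-king (out x) (out-∈Y x (Equivalence.from T-≡ ex)))

    chosen : V → ℕ
    chosen z = ∑[ x < suc n ] ([X] x * 𝟙 (out x == z))

    [X]*[Y]∘out : ∀ x d → [X] x * (d * [Y] (out x)) ≡ [X] x * d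
    [X]*[Y]∘out x d with inX x in ex
    ... | false = refl
    ... | true rewrite out-∈Y x (Equivalence.from T-≡ ex) = cong (1 *_) (*-identityʳ d)

    ∑[Y]*chosen≡|X| : ∑[ z < suc n ] ([Y] z * chosen z) ≡ |X|
    ∑[Y]*chosen≡|X| = begin
        ∑[ z < suc n ] ([Y] z * chosen z)
      ≡⟨ sum-cong-≗ (λ z → *-distribˡ-sum ([Y] z) (λ x → [X] x * δ x z)) ⟩
        ∑[ z < suc n ] ∑[ x < suc n ] ([Y] z * ([X] x * δ x z))
      ≡⟨ ∑-comm (λ z x → [Y] z * ([X] x * δ x z)) ⟩
        ∑[ x < suc n ] ∑[ z < suc n ] ([Y] z * ([X] x * δ x z))
      ≡⟨ sum-cong-≗ (λ x → sum-cong-≗ (λ z → reorder ([Y] z) ([X] x) (δ x z))) ⟩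
        ∑[ x < suc n ] ∑[ z < suc n ] (δ x z * ([X] x * (1 * [Y] z)))
      ≡⟨ sum-cong-≗ (λ x → ∑-δ (out x) (λ z → [X] x * (1 * [Y] z))) ⟩
        ∑[ x < suc n ] ([X] x * (1 * [Y] (out x)))
      ≡⟨ sum-cong-≗ (λ x → trans ([X]*[Y]∘out x 1) (*-identityʳ ([X] x))) ⟩
        |X| ∎
      where
      open ≡-Reasoning
      δ : V → V → ℕ
      δ x z = 𝟙 (out x == z)
      reorder : ∀ a b c → a * (b * c) ≡ c * (b * (1 * a))
      reorder = solve-∀

    ∑[Y]*chosen²≡collisions : ∑[ z < suc n ] ([Y] z * (chosen z * chosen z)) ≡ collisions
    ∑[Y]*chosen²≡collisions = begin
        ∑[ z < suc n ] ([Y] z * (chosen z * chosen z))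
      ≡⟨ sum-cong-≗ (λ z → trans (cong ([Y] z *_) (∑-product (f z) (f z))) (*-distribˡ-∑∑ ([Y] z) (λ i j → f z i * f z j))) ⟩
        ∑[ z < suc n ] ∑[ i < suc n ] ∑[ j < suc n ] ([Y] z * (f z i * f z j))
      ≡⟨ ∑-comm (λ z i → ∑[ j < suc n ] ([Y] z * (f z i * f z j))) ⟩
        ∑[ i < suc n ] ∑[ z < suc n ] ∑[ j < suc n ] ([Y] z * (f z i * f z j))
      ≡⟨ sum-cong-≗ (λ i → ∑-comm (λ z j → [Y] z * (f z i * f z j))) ⟩
        ∑[ i < suc n ] ∑[ j < suc n ] ∑[ z < suc n ] ([Y] z * (f z i * f z j))
      ≡⟨ sum-cong-≗ (λ i → sum-cong-≗ (λ j → sum-cong-≗ (λ z → reorder ([Y] z) ([X] i) (δ i z) ([X] j) (δ j z)))) ⟩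
        ∑[ i < suc n ] ∑[ j < suc n ] ∑[ z < suc n ] (δ j z * ([X] i * ([X] j * (δ i z * [Y] z))))
      ≡⟨ sum-cong-≗ (λ i → sum-cong-≗ (λ j → ∑-δ (out j) (λ z → [X] i * ([X] j * (δ i z * [Y] z))))) ⟩
        ∑[ i < suc n ] ∑[ j < suc n ] ([X] i * ([X] j * (δ i (out j) * [Y] (out j))))
      ≡⟨ sum-cong-≗ (λ i → sum-cong-≗ (λ j → cong ([X] i *_) ([X]*[Y]∘out j (δ i (out j))))) ⟩
        collisions ∎
      where
      open ≡-Reasoning
      δ : V → V → ℕ
      δ x z = 𝟙 (out x == z)
      f : V → V → ℕ
      f z x = [X] x * δ x z
      reorder : ∀ y a d b e → y * ((a * d) * (b * e)) ≡ e * (a * (b * (d * y)))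
      reorder = solve-∀

    |X|²≤|Y|*collisions : |X| * |X| ≤ |Y| * collisions
    |X|²≤|Y|*collisions = subst₂ _≤_ (cong₂ _*_ ∑[Y]*chosen≡|X| ∑[Y]*chosen≡|X|) (cong (|Y| *_) ∑[Y]*chosen²≡collisions)
                            (cauchy-schwarz [Y] chosen)

    [|Y|+1]*|X|≤2*|Y|*weight : (|Y| + 1) * |X| ≤ 2 * |Y| * weight king
    [|Y|+1]*|X|≤2*|Y|*weight = m*o*o≤n*o⇒m*o≤n (|Y| + 1) (2 * |Y| * weight king) |X| (begin
        (|Y| + 1) * |X| * |X|
      ≡⟨ e₁ |Y| |X| ⟩
        |Y| * (|X| * |X|) + |X| * |X|
      ≤⟨ +-monoʳ-≤ (|Y| * (|X| * |X|)) |X|²≤|Y|*collisions ⟩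
        |Y| * (|X| * |X|) + |Y| * collisions
      ≡⟨ *-distribˡ-+ |Y| (|X| * |X|) collisions ⟨
        |Y| * (|X| * |X| + collisions)
      ≤⟨ *-monoʳ-≤ |Y| |X|²+collisions≤2*total-weight ⟩
        |Y| * (total-weight + total-weight)
      ≤⟨ *-monoʳ-≤ |Y| (+-mono-≤ total-weight≤|X|*weight-king total-weight≤|X|*weight-king) ⟩
        |Y| * (|X| * weight king + |X| * weight king)
      ≡⟨ e₂ |Y| |X| (weight king) ⟩
        2 * |Y| * weight king * |X| ∎)
      where
      open ≤-Reasoning
      e₁ : ∀ m a → (m + 1) * a * a ≡ m * (a * a) + a * a
      e₁ = solve-∀
      e₂ : ∀ m a w → m * (a * w + a * w) ≡ 2 * m * w * a
      e₂ = solve-∀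

    bounded-quasiKernel : ∃[ Q ] (QuasiKernel D Q × AtMostBound (suc n) ∣ Q ∣)
    bounded-quasiKernel = Q , Q-quasiKernel , subst (λ n → AtMostBound n ∣ Q ∣) |X|+|Y|≡n bound
      where
      bound : AtMostBound (|X| + |Y|) ∣ Q ∣
      bound = atMostBound |X| |Y| ∣ Q ∣ (weight king) 1≤|Y| |Q|+weight≤1+|X| [|Y|+1]*|X|≤2*|Y|*weight

  bounded-quasiKernel : ∃[ Q ] (QuasiKernel D Q × AtMostBound (suc n) ∣ Q ∣)
  bounded-quasiKernel =
    KingAbsorption.bounded-quasiKernel (proj₁ score-maximiser) (proj₁ (proj₂ score-maximiser)) (proj₂ (proj₂ score-maximiser))

small-quasiKernel : (n : ℕ) (D : Digraph n) → OneWaySplit D → NoSinks D →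
  ∃[ Q ] (QuasiKernel D Q × AtMostBound n ∣ Q ∣)
small-quasiKernel zero    D _             _       = [] , ((λ ()) , (λ ())) , (z≤n , z≤n)
small-quasiKernel (suc n) D (inX , split) noSinks = UpperBound.bounded-quasiKernel D inX split noSinks

-- The extremal family

-- For a, b ≤ 2t: a → b iff b − a ∈ {1, …, t} modulo 2t + 1.
Rotational : ℕ → ℕ → ℕ → Set
Rotational t a b = (a < b × b ≤ a + t) ⊎ b + t < a

rotational? : ∀ t a b → Dec (Rotational t a b)
rotational? t a b = ((a <? b) ×-dec (b ≤? a + t)) ⊎-dec (b + t <? a)

rotational-irreflexive : ∀ t a → ¬ Rotational t a a
rotational-irreflexive t a (inj₁ (a<a , _)) = <-irrefl refl a<a
rotational-irreflexive t a (inj₂ a+t<a)     = <-irrefl refl (≤-trans (s≤s (m≤m+n a t)) a+t<a)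

rotational-asymmetric : ∀ t a b → Rotational t a b → ¬ Rotational t b a
rotational-asymmetric t a b (inj₁ (a<b , _))   (inj₁ (b<a , _))   = <-asym a<b b<a
rotational-asymmetric t a b (inj₁ (_ , b≤a+t)) (inj₂ a+t<b)       = <⇒≱ a+t<b b≤a+t
rotational-asymmetric t a b (inj₂ b+t<a)       (inj₁ (_ , a≤b+t)) = <⇒≱ b+t<a a≤b+t
rotational-asymmetric t a b (inj₂ b+t<a)       (inj₂ a+t<b)       =
  <-asym (≤-trans (s≤s (m≤m+n b t)) b+t<a) (≤-trans (s≤s (m≤m+n a t)) a+t<b)

rotational-connex : ∀ t a b → a ≢ b → Rotational t a b ⊎ Rotational t b a
rotational-connex t a b a≢b with <-cmp a b
... | tri≈ _ a≡b _ = ⊥-elim (a≢b a≡b)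
... | tri< a<b _ _ with b ≤? a + t
...   | yes b≤a+t = inj₁ (inj₁ (a<b , b≤a+t))
...   | no  b≰a+t = inj₂ (inj₂ (≰⇒> b≰a+t))
rotational-connex t a b a≢b | tri> _ _ b<a with a ≤? b + t
...   | yes a≤b+t = inj₂ (inj₁ (b<a , a≤b+t))
...   | no  a≰b+t = inj₁ (inj₂ (≰⇒> a≰b+t))

-- lo ≤ b < hi, phrased with _<ᵇ_ so that it reduces under suc on both sides.
∈[_,_⟩ : ℕ → ℕ → ℕ → Bool
∈[ lo , hi ⟩ b = (lo <ᵇ suc b) ∧ (b <ᵇ hi)

count-interval : ∀ M lo hi → lo ≤ hi → hi ≤ M → ∑[ i < M ] 𝟙 (∈[ lo , hi ⟩ (toℕ i)) ≡ hi ∸ lo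
count-interval zero    zero     zero     _           _          = refl
count-interval (suc M) zero     zero     _           _          = count-interval M zero zero z≤n z≤n
count-interval (suc M) zero     (suc hi) _           (s≤s hi≤M) = cong suc (count-interval M zero hi z≤n hi≤M)
count-interval (suc M) (suc lo) (suc hi) (s≤s lo≤hi) (s≤s hi≤M) = count-interval M lo hi lo≤hi hi≤M

count-below : ∀ M c → c ≤ M → ∑[ i < M ] 𝟙 (toℕ i <ᵇ c) ≡ c
count-below M c = count-interval M 0 c z≤n

∈[,⟩⁻ : ∀ lo hi b → T (∈[ lo , hi ⟩ b) → lo ≤ b × b < hi
∈[,⟩⁻ lo hi b p with lo<1+b , b<hi ← Equivalence.to T-∧ p = s≤s⁻¹ (<ᵇ⇒< lo (suc b) lo<1+b) , <ᵇ⇒< b hi b<hi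

rotational-outdegree : ∀ t a → a < suc (t + t) → t ≤ ∑[ b < suc (t + t) ] 𝟙 ⌊ rotational? t a (toℕ b) ⌋
rotational-outdegree t a a<M with ≤-total a t
... | inj₁ a≤t = begin
    t
  ≡⟨ m+n∸m≡n a t ⟨
    suc (a + t) ∸ suc a
  ≡⟨ count-interval M (suc a) (suc (a + t)) (s≤s (m≤m+n a t)) (s≤s (+-monoˡ-≤ t a≤t)) ⟨
    ∑[ b < M ] 𝟙 (∈[ suc a , suc (a + t) ⟩ (toℕ b))
  ≤⟨ ∑-mono-≤ {M} (λ b → 𝟙-mono {∈[ suc a , suc (a + t) ⟩ (toℕ b)} (ahead (toℕ b))) ⟩
    ∑[ b < M ] 𝟙 ⌊ rotational? t a (toℕ b) ⌋ ∎
  where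
  open ≤-Reasoning
  M : ℕ
  M = suc (t + t)
  ahead : ∀ b → T (∈[ suc a , suc (a + t) ⟩ b) → T ⌊ rotational? t a b ⌋
  ahead b p with a<b , b<1+a+t ← ∈[,⟩⁻ (suc a) (suc (a + t)) b p = fromWitness (inj₁ (a<b , s≤s⁻¹ b<1+a+t))
... | inj₂ t≤a with d , refl ← m≤n⇒∃[o]m+o≡n t≤a = begin
    t
  ≡⟨ m∸n+n≡m d≤t ⟨
    t ∸ d + d
  ≡⟨ cong₂ _+_ count-above count-below-d ⟨
    ∑[ b < M ] 𝟙 (∈[ suc (t + d) , M ⟩ (toℕ b)) + ∑[ b < M ] 𝟙 (toℕ b <ᵇ d)
  ≡⟨ ∑-distrib-+ {M} (λ b → 𝟙 (∈[ suc (t + d) , M ⟩ (toℕ b))) (λ b → 𝟙 (toℕ b <ᵇ d)) ⟨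
    ∑[ b < M ] (𝟙 (∈[ suc (t + d) , M ⟩ (toℕ b)) + 𝟙 (toℕ b <ᵇ d))
  ≤⟨ ∑-mono-≤ {M} (λ b → covered (toℕ b)) ⟩
    ∑[ b < M ] 𝟙 ⌊ rotational? t (t + d) (toℕ b) ⌋ ∎
  where
  open ≤-Reasoning
  M : ℕ
  M = suc (t + t)
  d≤t : d ≤ t
  d≤t = +-cancelˡ-≤ t d t (s≤s⁻¹ a<M)
  count-above : ∑[ b < M ] 𝟙 (∈[ suc (t + d) , M ⟩ (toℕ b)) ≡ t ∸ d
  count-above = trans (count-interval M (suc (t + d)) M a<M ≤-refl) ([m+n]∸[m+o]≡n∸o t t d)
  count-below-d : ∑[ b < M ] 𝟙 (toℕ b <ᵇ d) ≡ d
  count-below-d = count-below M d (≤-trans d≤t (≤-trans (m≤m+n t t) (n≤1+n _)))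
  above : ∀ b → T (∈[ suc (t + d) , M ⟩ b) → T ⌊ rotational? t (t + d) b ⌋
  above b p with a<b , b<M ← ∈[,⟩⁻ (suc (t + d)) M b p = fromWitness (inj₁ (a<b , ≤-trans (s≤s⁻¹ b<M) (+-monoˡ-≤ t (m≤m+n t d))))
  below : ∀ b → T (b <ᵇ d) → T ⌊ rotational? t (t + d) b ⌋
  below b p = fromWitness (inj₂ (subst (b + t <_) (+-comm d t) (+-monoˡ-< t (<ᵇ⇒< b d p))))
  disjoint : ∀ b → T (∈[ suc (t + d) , M ⟩ b) → T (b <ᵇ d) → ⊥
  disjoint b p q = <⇒≱ (≤-trans (<ᵇ⇒< b d q) (m≤n+m d t)) (<⇒≤ (proj₁ (∈[,⟩⁻ (suc (t + d)) M b p)))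
  covered : ∀ b → 𝟙 (∈[ suc (t + d) , M ⟩ b) + 𝟙 (b <ᵇ d) ≤ 𝟙 ⌊ rotational? t (t + d) b ⌋
  covered b = 𝟙-disjoint-≤ {∈[ suc (t + d) , M ⟩ b} {b <ᵇ d} (above b) (below b) (disjoint b)

module Construction (t : ℕ) (1≤t : 1 ≤ t) where

  M : ℕ
  M = suc (t + t)

  -- (i , zero) is vertex i of the tournament Y; the (i , suc j) are its 2t pendant vertices in X.
  Cell : Set
  Cell = Fin M × Fin M

  rot : Fin M → Fin M → Bool
  rot i i' = ⌊ rotational? t (toℕ i) (toℕ i') ⌋

  cellArc : Cell → Cell → Bool
  cellArc _         (_  , suc _) = false
  cellArc (i , zero)  (i' , zero) = rot i i'
  cellArc (i , suc _) (i' , zero) = i == i'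

  pendant : Cell → Bool
  pendant (_ , zero)  = false
  pendant (_ , suc _) = true

  cell : Fin (M * M) → Cell
  cell = remQuot M

  vertex : Cell → Fin (M * M)
  vertex = uncurry combine

  cell∘vertex : ∀ p → cell (vertex p) ≡ p
  cell∘vertex (i , j) = remQuot-combine i j

  vertex∘cell : ∀ v → vertex (cell v) ≡ v
  vertex∘cell = combine-remQuot M

  cellArc-irreflexive : ∀ p → cellArc p p ≡ false
  cellArc-irreflexive (i , zero)  = Equivalence.to T-not-≡ (fromWitnessFalse (rotational-irreflexive t (toℕ i)))
  cellArc-irreflexive (i , suc _) = refl

  D : Digraph (M * M)
  D = record { arc = λ v w → cellArc (cell v) (cell w) ; loopless = cellArc-irreflexive ∘ cell }

  no-arc-into-pendant : ∀ p q → T (pendant q) → ¬ T (cellArc p q)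
  no-arc-into-pendant p (_ , suc _) _ ()

  cells-semicomplete : ∀ p q → pendant p ≡ false → pendant q ≡ false → p ≢ q →
    T (cellArc p q) ⊎ T (cellArc q p)
  cells-semicomplete (i , zero) (i' , zero) _ _ p≢q =
    Sum.map fromWitness fromWitness
      (rotational-connex t (toℕ i) (toℕ i') (λ eq → p≢q (cong (_, zero) (toℕ-injective eq))))

  oneWaySplit : OneWaySplit D
  oneWaySplit = pendant ∘ cell
              , (λ u v _ v∈X → no-arc-into-pendant (cell u) (cell v) v∈X)
              , (λ u v u∈Y v∈Y u≢v → cells-semicomplete (cell u) (cell v) u∈Y v∈Y (λ eq → u≢v (cell-injective eq)))
              , (λ u v _ v∈X → no-arc-into-pendant (cell u) (cell v) v∈X)
    where
    cell-injective : ∀ {v w} → cell v ≡ cell w → v ≡ w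
    cell-injective {v} {w} eq = trans (sym (vertex∘cell v)) (trans (cong vertex eq) (vertex∘cell w))

  arc-to-vertex : ∀ v q → T (cellArc (cell v) q) → Arc D v (vertex q)
  arc-to-vertex v q = subst (T ∘ cellArc (cell v)) (sym (cell∘vertex q))

  arc-between : ∀ p q → T (cellArc p q) → Arc D (vertex p) (vertex q)
  arc-between p q p→q = arc-to-vertex (vertex p) q (subst (λ r → T (cellArc r q)) (sym (cell∘vertex p)) p→q)

  cell-successor : ∀ p → ∃ λ q → T (cellArc p q)
  cell-successor (i , suc _) = (i , zero) , ==-refl i
  cell-successor (i , zero) with toℕ i <? t + t
  ... | yes i<2t = (fromℕ< (s≤s i<2t) , zero) ,
          fromWitness (inj₁ (subst (toℕ i <_) (sym i+1) ≤-refl , subst (_≤ toℕ i + t) (sym i+1) (1+a≤a+t (toℕ i))))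
    where
    i+1 : toℕ (fromℕ< (s≤s i<2t)) ≡ suc (toℕ i)
    i+1 = toℕ-fromℕ< (s≤s i<2t)
    1+a≤a+t : ∀ a → suc a ≤ a + t
    1+a≤a+t a = subst (_≤ a + t) (+-comm a 1) (+-monoʳ-≤ a 1≤t)
  ... | no i≮2t = (zero , zero) , fromWitness (inj₂ (≤-trans (subst (_≤ t + t) (+-comm t 1) (+-monoʳ-≤ t 1≤t)) (≮⇒≥ i≮2t)))

  noSinks : NoSinks D
  noSinks v with q , v→q ← cell-successor (cell v) = vertex q , arc-to-vertex v q v→q

  CellReach : Cell → Cell → Set
  CellReach p q = T (cellArc p q) ⊎ ∃ λ r → T (cellArc p r) × T (cellArc r q)

  reach⇒cellReach : ∀ v w → Reach≤2 D v w → CellReach (cell v) (cell w)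
  reach⇒cellReach v w (inj₁ v→w)           = inj₁ v→w
  reach⇒cellReach v w (inj₂ (x , v→x , x→w)) = inj₂ (cell x , v→x , x→w)

  cellReach⇒reach : ∀ {v w} → CellReach (cell v) (cell w) → Reach≤2 D v w
  cellReach⇒reach         (inj₁ v→w)           = inj₁ v→w
  cellReach⇒reach {v} {w} (inj₂ (r , v→r , r→w)) =
    inj₂ (vertex r , arc-to-vertex v r v→r , subst (λ r → T (cellArc r (cell w))) (sym (cell∘vertex r)) r→w)

  last : Fin M
  last = fromℕ (t + t)

  toℕ-last : toℕ last ≡ t + t
  toℕ-last = toℕ-fromℕ (t + t)

  rot-last : ∀ i → t ≤ toℕ i → i ≢ last → T (rot i last)
  rot-last i t≤i i≢last = fromWitness (inj₁ (i<2t , 2t≤i+t))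
    where
    2t≤i+t : toℕ last ≤ toℕ i + t
    2t≤i+t = subst₂ _≤_ (sym toℕ-last) (+-comm t (toℕ i)) (+-monoʳ-≤ t t≤i)
    i<2t : toℕ i < toℕ last
    i<2t = subst (toℕ i <_) (sym toℕ-last) (≤∧≢⇒< (s≤s⁻¹ (toℕ<n i)) (λ eq → i≢last (toℕ-injective (trans eq (sym toℕ-last)))))

  inQ : Cell → Bool
  inQ (i , zero)  = last == i
  inQ (i , suc _) = toℕ i <ᵇ t

  Q : Subset (M * M)
  Q = tabulate (inQ ∘ cell)

  inQ-independent : ∀ p q → T (inQ p) → T (inQ q) → ¬ T (cellArc p q)
  inQ-independent p           (_  , suc _) _    _    ()
  inQ-independent (i , zero)  (i' , zero)  p∈Q  q∈Q  p→q with refl ← ==⇒≡ p∈Q | refl ← ==⇒≡ q∈Q =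
    rotational-irreflexive t (toℕ last) (toWitness p→q)
  inQ-independent (i , suc _) (i' , zero)  i<t  q∈Q  p→q with refl ← ==⇒≡ p→q | refl ← ==⇒≡ q∈Q =
    <⇒≱ (<ᵇ⇒< (toℕ last) t i<t) (subst (t ≤_) (sym toℕ-last) (m≤m+n t t))

  inQ-absorbing : ∀ p → ¬ T (inQ p) → CellReach p (last , zero)
  inQ-absorbing (i , suc _) i≮t = case i ≟ᶠ last of λ where
    (yes refl)  → inj₁ (==-refl last)
    (no i≢last) → inj₂ ((i , zero) , ==-refl i , rot-last i (≮⇒≥ (i≮t ∘ <⇒<ᵇ)) i≢last)
  inQ-absorbing (i , zero) last≢i with t ≤? toℕ i
  ... | yes t≤i = inj₁ (rot-last i t≤i (λ { refl → last≢i (==-refl last) }))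
  ... | no  t≰i = inj₂ ((i+t , zero) , fromWitness (inj₁ (i<i+t , ≤-reflexive toℕ-i+t)) , rot-last i+t t≤i+t i+t≢last)
    where
    i+t<M : toℕ i + t < M
    i+t<M = s≤s (+-monoˡ-≤ t (<⇒≤ (≰⇒> t≰i)))
    i+t : Fin M
    i+t = fromℕ< i+t<M
    toℕ-i+t : toℕ i+t ≡ toℕ i + t
    toℕ-i+t = toℕ-fromℕ< i+t<M
    i<i+t : toℕ i < toℕ i+t
    i<i+t = subst (toℕ i <_) (sym toℕ-i+t) (subst (_≤ toℕ i + t) (+-comm (toℕ i) 1) (+-monoʳ-≤ (toℕ i) 1≤t))
    t≤i+t : t ≤ toℕ i+t
    t≤i+t = subst (t ≤_) (sym toℕ-i+t) (m≤n+m t (toℕ i))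
    i+t≢last : i+t ≢ last
    i+t≢last eq = <-irrefl (trans (sym toℕ-i+t) (trans (cong toℕ eq) toℕ-last)) (+-monoˡ-< t (≰⇒> t≰i))

  Q-quasiKernel : QuasiKernel D Q
  Q-quasiKernel = independent , absorbing
    where
    independent : Independent D Q
    independent v w v∈Q w∈Q =
      inQ-independent (cell v) (cell w) (∈-tabulate⁻ (inQ ∘ cell) v∈Q) (∈-tabulate⁻ (inQ ∘ cell) w∈Q)
    hub : Fin (M * M)
    hub = vertex (last , zero)
    hub∈Q : hub ∈ Q
    hub∈Q = ∈-tabulate⁺ (inQ ∘ cell) (subst (T ∘ inQ) (sym (cell∘vertex (last , zero))) (==-refl last))
    absorbing : ∀ v → v ∉ Q → ∃[ q ] (q ∈ Q × Reach≤2 D v q)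
    absorbing v v∉Q = hub , hub∈Q , cellReach⇒reach {v} {hub}
      (subst (CellReach (cell v)) (sym (cell∘vertex (last , zero))) (inQ-absorbing (cell v) (v∉Q ∘ ∈-tabulate⁺ (inQ ∘ cell))))

  k : ℕ
  k = 1 + (t + t) * t

  ∑-cells : ∀ (g : Cell → ℕ) → ∑[ v < M * M ] g (cell v) ≡ ∑[ i < M ] (g (i , zero) + ∑[ j < t + t ] g (i , suc j))
  ∑-cells g = trans (∑-combine M (g ∘ cell)) (sum-cong-≗ (λ i → sum-cong-≗ (λ j → cong g (cell∘vertex (i , j)))))

  ∣Q∣≡k : ∣ Q ∣ ≡ k
  ∣Q∣≡k = begin
      ∣ Q ∣
    ≡⟨ ∣tabulate∣≡∑ (inQ ∘ cell) ⟩
      ∑[ v < M * M ] 𝟙 (inQ (cell v))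
    ≡⟨ ∑-cells (𝟙 ∘ inQ) ⟩
      ∑[ i < M ] (𝟙 (last == i) + ∑[ j < t + t ] 𝟙 (toℕ i <ᵇ t))
    ≡⟨ ∑-+-∑-const (t + t) (λ i → 𝟙 (last == i)) (λ i → 𝟙 (toℕ i <ᵇ t)) ⟩
      ∑[ i < M ] 𝟙 (last == i) + (t + t) * ∑[ i < M ] 𝟙 (toℕ i <ᵇ t)
    ≡⟨ cong₂ (λ a b → a + (t + t) * b) (∑-== last) (count-below M t (≤-trans (m≤m+n t t) (n≤1+n _))) ⟩
      k ∎
    where open ≡-Reasoning

  arc-target : ∀ p q → T (cellArc p q) → ∃ λ i → q ≡ (i , zero)
  arc-target p (i , zero) _ = i , refl

  cellReach-target : ∀ p q → CellReach p q → ∃ λ i → q ≡ (i , zero)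
  cellReach-target p q (inj₁ p→q)           = arc-target p q p→q
  cellReach-target p q (inj₂ (r , _ , r→q)) = arc-target r q r→q

  reach-target : ∀ v w → Reach≤2 D v w → ∃ λ i → w ≡ vertex (i , zero)
  reach-target v w r with i , eq ← cellReach-target (cell v) (cell w) (reach⇒cellReach v w r) =
    i , trans (sym (vertex∘cell w)) (cong vertex eq)

  pendant-reach : ∀ {i j i'} → CellReach (i , suc j) (i' , zero) → i ≡ i' ⊎ T (rot i i')
  pendant-reach (inj₁ i=i')                         = inj₁ (==⇒≡ i=i')
  pendant-reach (inj₂ ((r , zero) , i=r , r→i')) with refl ← ==⇒≡ i=r = inj₂ r→i'

  module MinimumSize (Q′ : Subset (M * M)) (Q′-quasiKernel : QuasiKernel D Q′) where

    Q′-independent : Independent D Q′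
    Q′-independent = proj₁ Q′-quasiKernel

    Q′-absorbing : ∀ v → v ∉ Q′ → ∃[ q ] (q ∈ Q′ × Reach≤2 D v q)
    Q′-absorbing = proj₂ Q′-quasiKernel

    Y-vertex-in-Q′ : ∃ λ i → vertex (i , zero) ∈ Q′
    Y-vertex-in-Q′ with vertex (zero , zero) ∈? Q′
    ... | yes v∈Q′ = zero , v∈Q′
    ... | no  v∉Q′ = let q , q∈Q′ , v↝q = Q′-absorbing (vertex (zero , zero)) v∉Q′
                         i , q≡i      = reach-target (vertex (zero , zero)) q v↝q
                     in  i , subst (_∈ Q′) q≡i q∈Q′

    Y-unique : ∀ i i' → vertex (i , zero) ∈ Q′ → vertex (i' , zero) ∈ Q′ → i ≡ i'
    Y-unique i i' i∈Q′ i'∈Q′ with i ≟ᶠ i'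
    ... | yes i≡i' = i≡i'
    ... | no  i≢i' with cells-semicomplete (i , zero) (i' , zero) refl refl (i≢i' ∘ cong proj₁)
    ...   | inj₁ i→i' = ⊥-elim (Q′-independent _ _ i∈Q′ i'∈Q′ (arc-between (i , zero) (i' , zero) i→i'))
    ...   | inj₂ i'→i = ⊥-elim (Q′-independent _ _ i'∈Q′ i∈Q′ (arc-between (i' , zero) (i , zero) i'→i))

    i₀ : Fin M
    i₀ = proj₁ Y-vertex-in-Q′

    i₀∈Q′ : vertex (i₀ , zero) ∈ Q′
    i₀∈Q′ = proj₂ Y-vertex-in-Q′

    out-neighbour-pendants-in-Q′ : ∀ i j → T (rot i₀ i) → vertex (i , suc j) ∈ Q′
    out-neighbour-pendants-in-Q′ i j i₀→i with vertex (i , suc j) ∈? Q′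
    ... | yes p∈Q′ = p∈Q′
    ... | no  p∉Q′ = ⊥-elim ([ (λ { refl → rotational-irreflexive t (toℕ i) (toWitness i₀→i) })
                             , rotational-asymmetric t (toℕ i₀) (toℕ i) (toWitness i₀→i) ∘ toWitness ]′ (pendant-reach p↝i₀))
      where
      p : Fin (M * M)
      p = vertex (i , suc j)
      absorber : ∃[ q ] (q ∈ Q′ × Reach≤2 D p q)
      absorber = Q′-absorbing p p∉Q′
      q : Fin (M * M)
      q = proj₁ absorber
      p↝q : Reach≤2 D p q
      p↝q = proj₂ (proj₂ absorber)
      iq : Fin M
      iq = proj₁ (reach-target p q p↝q)
      q≡iq : q ≡ vertex (iq , zero)
      q≡iq = proj₂ (reach-target p q p↝q)
      q≡i₀ : q ≡ vertex (i₀ , zero)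
      q≡i₀ = trans q≡iq (cong (vertex ∘ (_, zero)) (Y-unique iq i₀ (subst (_∈ Q′) q≡iq (proj₁ (proj₂ absorber))) i₀∈Q′))
      p↝i₀ : CellReach (i , suc j) (i₀ , zero)
      p↝i₀ = subst₂ CellReach (cell∘vertex (i , suc j)) (trans (cong cell q≡i₀) (cell∘vertex (i₀ , zero))) (reach⇒cellReach p q p↝q)

    forced : Cell → ℕ
    forced (i , zero)  = 𝟙 (i₀ == i)
    forced (i , suc _) = 𝟙 (rot i₀ i)

    forced≤Q′ : ∀ p → forced p ≤ 𝟙 (lookup Q′ (vertex p))
    forced≤Q′ (i , zero)  = 𝟙-mono (λ i₀=i → ∈⇒lookup (subst (λ i → vertex (i , zero) ∈ Q′) (==⇒≡ i₀=i) i₀∈Q′))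
    forced≤Q′ (i , suc j) = 𝟙-mono (∈⇒lookup ∘ out-neighbour-pendants-in-Q′ i j)

    k≤∣Q′∣ : k ≤ ∣ Q′ ∣
    k≤∣Q′∣ = begin
        1 + (t + t) * t
      ≤⟨ +-monoʳ-≤ 1 (*-monoʳ-≤ (t + t) (rotational-outdegree t (toℕ i₀) (toℕ<n i₀))) ⟩
        1 + (t + t) * ∑[ i < M ] 𝟙 (rot i₀ i)
      ≡⟨ cong (_+ (t + t) * ∑[ i < M ] 𝟙 (rot i₀ i)) (∑-== i₀) ⟨
        ∑[ i < M ] 𝟙 (i₀ == i) + (t + t) * ∑[ i < M ] 𝟙 (rot i₀ i)
      ≡⟨ ∑-+-∑-const (t + t) (λ i → 𝟙 (i₀ == i)) (λ i → 𝟙 (rot i₀ i)) ⟨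
        ∑[ i < M ] (forced (i , zero) + ∑[ j < t + t ] forced (i , suc j))
      ≡⟨ ∑-cells forced ⟨
        ∑[ v < M * M ] forced (cell v)
      ≤⟨ ∑-mono-≤ (λ v → forced≤Q′ (cell v)) ⟩
        ∑[ v < M * M ] 𝟙 (lookup Q′ (vertex (cell v)))
      ≡⟨ sum-cong-≗ (λ v → cong (𝟙 ∘ lookup Q′) (vertex∘cell v)) ⟩
        ∑[ v < M * M ] 𝟙 (lookup Q′ v)
      ≡⟨ ∣p∣≡∑ Q′ ⟨
        ∣ Q′ ∣ ∎
      where open ≤-Reasoning

  minQuasiKernelSize : MinQuasiKernelSize D k
  minQuasiKernelSize = (Q , Q-quasiKernel , ∣Q∣≡k) , MinimumSize.k≤∣Q′∣

  k-equalsBound : EqualsBound (M * M) k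
  k-equalsBound = M , refl , identity t
    where
    identity : ∀ t → 2 * (1 + (t + t) * t) + 2 * suc (t + t) ≡ suc (t + t) * suc (t + t) + 3
    identity = solve-∀

extremal-family : (N : ℕ) → ∃[ n ] (N ≤ n × ∃[ D ] (OneWaySplit {n} D × NoSinks D ×
  ∃[ k ] (MinQuasiKernelSize D k × EqualsBound n k)))
extremal-family N = M * M , N≤M² , D , oneWaySplit , noSinks , k , minQuasiKernelSize , k-equalsBound
  where
  open Construction (suc N) (s≤s z≤n)
  N≤M² : N ≤ M * M
  N≤M² = ≤-trans (≤-trans (n≤1+n N) (≤-trans (m≤m+n (suc N) (suc N)) (n≤1+n _))) (m≤m*n M M)

theorem6 :
    ((n : ℕ) (D : Digraph n) → OneWaySplit D → NoSinks D →
      ∃[ Q ] (QuasiKernel D Q × AtMostBound n ∣ Q ∣))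
    ×
    ((N : ℕ) → ∃[ n ] (N ≤ n × ∃[ D ] (OneWaySplit {n} D × NoSinks D ×
      ∃[ k ] (MinQuasiKernelSize D k × EqualsBound n k))))
theorem6 = small-quasiKernel , extremal-family
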